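{- Let $p>3$ be a prime, $t\in \{1,3,p,3p\}$, and $1\leqslant r\leqslant 3p-1$ with $\gcd(r,3p)=1$. Then \[\mathcal{S}(1,r,t)=\begin{cases} 0 & \text{if } r\equiv 1\pmod 3,\\ |r|_p-1 & \text{if } r\equiv 2\pmod 3\text{ and $|r|_p$ is odd},\\ \frac{|r|_p}{2} & \text{if } r\equiv 2\pmod 3\text{ and $|r|_p$ is even}. \end{cases}\]
   Context: $\phi$ is Euler's totient function; $|r|_m$ is the multiplicative order of $r$ modulo $m$. $S_k(x)=1+x+\cdots+x^{k-1}$ for $k\ge1$, $S_0(x)=0$; for a positive integer $m$ with $\gcd(r,m)=1$, $\kappa(m,r,t)=\dfrac{m|r|_m}{\gcd(m,\ tS_{|r|_m}(r))}$. For a divisor $d$ of $3p$, $\Lambda(d,r,t)=\{\ell>0\mid \ell \text{ divides } \frac{|r|_{3p}}{\gcd(\kappa(d,r,t),|r|_{3p})} \text{ and } \gcd(r^{\ell\kappa(d,r,t)}-1,3p)=d\}$ and $\mathcal{S}(d,r,t)=\sum_{\ell\in \Lambda(d,r,t)} d\,\phi\!\left(\frac{|r|_{3p}}{\ell \gcd(\kappa(d,r,t),|r|_{3p})}\right)$. -}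

module Defs where

open import Data.Nat using (ℕ; zero; suc; _+_; _*_; _∸_; _^_; _≡ᵇ_)
open import Data.Nat.DivMod using (_%_; _/_)
open import Data.Nat.GCD using (gcd)
open import Data.Nat.Divisibility using (_∣?_)
open import Data.Bool using (Bool; true; false; if_then_else_; _∧_)
open import Relation.Nullary.Decidable using (⌊_⌋)
open import Data.List using (List; []; _∷_; map; filterᵇ)
open import Data.Nat.ListAction using (sum)

range1 : ℕ → List ℕ
range1 zero = []
range1 (suc n) = range1 n Data.List.++ (suc n ∷ [])

-- total division: a div 0 = 0 (only used with nonzero divisors)
_div_ : ℕ → ℕ → ℕ
a div zero = 0
a div suc b = a / suc b

≡1mod : ℕ → ℕ → Bool
≡1mod a zero = a ≡ᵇ 1
≡1mod a (suc m) = (a % suc m) ≡ᵇ (1 % suc m)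

φ : ℕ → ℕ
φ n = Data.List.length (filterᵇ (λ k → gcd k n ≡ᵇ 1) (range1 n))

firstOrd : ℕ → ℕ → List ℕ → ℕ
firstOrd m r [] = 0
firstOrd m r (k ∷ ks) = if ≡1mod (r ^ k) m then k else firstOrd m r ks

-- multiplicative order |r|_m : least k ≥ 1 with r^k ≡ 1 (mod m).
-- For gcd(r,m)=1, m ≥ 1 this order exists and is ≤ m, so searching 1..m suffices.
ord : ℕ → ℕ → ℕ
ord m r = firstOrd m r (range1 m)

S : ℕ → ℕ → ℕ
S zero x = 0
S (suc k) x = S k x + x ^ k

κ : ℕ → ℕ → ℕ → ℕ
κ m r t = (m * ord m r) div gcd m (t * S (ord m r) r)

Λ : ℕ → ℕ → ℕ → ℕ → List ℕ
Λ p d r t =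
  let o = ord (3 * p) r
      k = κ d r t
      N = o div gcd k o
  in filterᵇ (λ ℓ → ⌊ ℓ ∣? N ⌋ ∧ (gcd (r ^ (ℓ * k) ∸ 1) (3 * p) ≡ᵇ d)) (range1 N)

𝒮 : ℕ → ℕ → ℕ → ℕ → ℕ
𝒮 p d r t =
  let o = ord (3 * p) r
      k = κ d r t
  in sum (map (λ ℓ → d * φ (o div (ℓ * gcd k o))) (Λ p d r t))

{-# OPTIONS --safe #-}
-- Since κ(1, r, t) = 1, 𝒮(1, r, t) = Σ φ(o/ℓ) over the divisors ℓ of o = |r|₃ₚ with gcd(rˡ − 1, 3p) = 1.
-- Grouping the k ∈ [1, o] by gcd(k, o), this is the number of k ∈ [1, o] for which ℓ = gcd(k, o) satisfies
-- that condition. If r ≡ 1 (mod 3) then 3 divides every rˡ − 1 and nothing is counted. If r ≡ 2 (mod 3)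
-- then |r|₃ = 2, so with m = |r|ₚ the condition says that ℓ is odd and m ∤ ℓ; since 2 and m divide o it
-- may be tested on k instead of gcd(k, o). Finally o = lcm(2, m), i.e. 2m for odd m and m for even m,
-- and [1, o] contains m − 1, resp. m/2, odd numbers that are not multiples of m.
module Submission where

open import Defs
open import Data.Bool.Base using (Bool; true; false; T; not; _∧_; if_then_else_)
open import Data.Bool.Properties using (∧-zeroʳ)
open import Data.Empty using (⊥-elim)
open import Data.Fin.Base using (Fin; toℕ; fromℕ<)
import Data.Fin.Properties as Fin
open import Data.List.Base using ([]; _∷_; [_]; _++_; map; filterᵇ; length; applyUpTo)
open import Data.List.Properties using (applyUpTo-∷ʳ; map-++)
open import Data.Nat.Base
open import Data.Nat.Properties
open import Data.Nat.Divisibility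
open import Data.Nat.DivMod hiding (_div_)
open import Data.Nat.GCD
open import Data.Nat.Coprimality using (Coprime; coprime-divisor; coprime⇒gcd≡1; gcd≡1⇒coprime; prime⇒coprime)
open import Data.Nat.Primality using (Prime; prime?; prime[2]; prime⇒irreducible; prime⇒nonTrivial; prime⇒nonZero)
open import Data.Nat.ListAction using (sum)
open import Data.Nat.ListAction.Properties using (sum-++)
open import Data.Nat.Tactic.RingSolver using (solve-∀)
open import Data.Product.Base using (_×_; _,_; proj₁; proj₂; ∃-syntax)
open import Data.Sum.Base using (_⊎_; inj₁; inj₂)
open import Function.Base using (_∘_; case_of_)
open import Function.Bundles using (_⇔_; mk⇔; Equivalence)
open import Relation.Nullary.Decidable using (yes; no; does; ⌊_⌋; dec-true; dec-false; does-⇔; from-yes; ¬?; _×-dec_)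
open import Relation.Nullary.Negation using (¬_; contradiction)
open import Relation.Binary.PropositionalEquality hiding ([_])

-- Finite sums

𝟙 : Bool → ℕ
𝟙 true  = 1
𝟙 false = 0

𝟙-∧-* : ∀ a b c → 𝟙 (a ∧ b) * c ≡ 𝟙 b * (𝟙 a * c)
𝟙-∧-* false b c = sym (*-zeroʳ (𝟙 b))
𝟙-∧-* true  b c = cong (𝟙 b *_) (sym (+-identityʳ c))

𝟙-≡ᵇ-≢ : ∀ {x y} → x ≢ y → 𝟙 (x ≡ᵇ y) ≡ 0
𝟙-≡ᵇ-≢ x≢y = cong 𝟙 (dec-false (_ ≟ _) x≢y)

-- ∑ n f = f 1 + ⋯ + f n, indexed like range1 n = [1, …, n]
∑ : ℕ → (ℕ → ℕ) → ℕ
∑ zero    f = 0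
∑ (suc n) f = ∑ n f + f (suc n)

∑-cong : ∀ n {f g : ℕ → ℕ} → (∀ {k} → 1 ≤ k → k ≤ n → f k ≡ g k) → ∑ n f ≡ ∑ n g
∑-cong zero    f≡g = refl
∑-cong (suc n) f≡g =
  cong₂ _+_ (∑-cong n (λ 1≤k k≤n → f≡g 1≤k (m≤n⇒m≤1+n k≤n))) (f≡g z<s ≤-refl)

∑-zero : ∀ n {f : ℕ → ℕ} → (∀ {k} → 1 ≤ k → k ≤ n → f k ≡ 0) → ∑ n f ≡ 0
∑-zero zero    f≡0 = refl
∑-zero (suc n) f≡0 =
  cong₂ _+_ (∑-zero n (λ 1≤k k≤n → f≡0 1≤k (m≤n⇒m≤1+n k≤n))) (f≡0 z<s ≤-refl)

∑-+ : ∀ n (f g : ℕ → ℕ) → ∑ n (λ k → f k + g k) ≡ ∑ n f + ∑ n g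
∑-+ zero    f g = refl
∑-+ (suc n) f g = begin
  ∑ n (λ k → f k + g k) + (f (suc n) + g (suc n))  ≡⟨ cong (_+ (f (suc n) + g (suc n))) (∑-+ n f g) ⟩
  ∑ n f + ∑ n g + (f (suc n) + g (suc n))          ≡⟨ +-interchange (∑ n f) (∑ n g) (f (suc n)) (g (suc n)) ⟩
  ∑ n f + f (suc n) + (∑ n g + g (suc n))          ∎
  where
  open ≡-Reasoning
  +-interchange : ∀ a b c d → a + b + (c + d) ≡ a + c + (b + d)
  +-interchange = solve-∀

∑-*ˡ : ∀ n c (f : ℕ → ℕ) → c * ∑ n f ≡ ∑ n (λ k → c * f k)
∑-*ˡ zero    c f = *-zeroʳ c
∑-*ˡ (suc n) c f = trans (*-distribˡ-+ c (∑ n f) (f (suc n))) (cong (_+ c * f (suc n)) (∑-*ˡ n c f))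

∑-swap : ∀ m n (h : ℕ → ℕ → ℕ) → ∑ m (λ i → ∑ n (h i)) ≡ ∑ n (λ j → ∑ m (λ i → h i j))
∑-swap zero    n h = sym (∑-zero n (λ _ _ → refl))
∑-swap (suc m) n h =
  trans (cong (_+ ∑ n (h (suc m))) (∑-swap m n h)) (sym (∑-+ n (λ j → ∑ m (λ i → h i j)) (h (suc m))))

∑-split : ∀ a b (f : ℕ → ℕ) → ∑ (a + b) f ≡ ∑ a f + ∑ b (λ i → f (a + i))
∑-split a zero    f = trans (cong (λ n → ∑ n f) (+-identityʳ a)) (sym (+-identityʳ (∑ a f)))
∑-split a (suc b) f = begin
  ∑ (a + suc b) f                                  ≡⟨ cong (λ n → ∑ n f) (+-suc a b) ⟩
  ∑ (a + b) f + f (suc (a + b))                    ≡⟨ cong₂ _+_ (∑-split a b f) (cong f (sym (+-suc a b))) ⟩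
  ∑ a f + ∑ b (λ i → f (a + i)) + f (a + suc b)    ≡⟨ +-assoc (∑ a f) _ _ ⟩
  ∑ a f + (∑ b (λ i → f (a + i)) + f (a + suc b))  ∎
  where open ≡-Reasoning

∑-multiples : ∀ l q (f : ℕ → ℕ) → (∀ k → ¬ suc l ∣ k → f k ≡ 0) →
              ∑ (q * suc l) f ≡ ∑ q (λ j → f (j * suc l))
∑-multiples l zero    f f-vanishes = refl
∑-multiples l (suc q) f f-vanishes = begin
  ∑ (suc q * ℓ) f                                            ≡⟨ cong (λ n → ∑ n f) (+-comm ℓ (q * ℓ)) ⟩
  ∑ (q * ℓ + ℓ) f                                            ≡⟨ ∑-split (q * ℓ) ℓ f ⟩
  ∑ (q * ℓ) f + (∑ l (λ i → f (q * ℓ + i)) + f (q * ℓ + ℓ))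
    ≡⟨ cong₂ _+_ (∑-multiples l q f f-vanishes) (cong₂ _+_ between (cong f (+-comm (q * ℓ) ℓ))) ⟩
  ∑ q (λ j → f (j * ℓ)) + f (suc q * ℓ)                      ∎
  where
  open ≡-Reasoning
  ℓ = suc l
  between : ∑ l (λ i → f (q * ℓ + i)) ≡ 0
  between = ∑-zero l λ {i} 1≤i i≤l → f-vanishes (q * ℓ + i) λ ℓ∣ →
    >⇒∤ {{>-nonZero 1≤i}} (s≤s i≤l) (∣m+n∣m⇒∣n ℓ∣ (n∣m*n q))

∑-select : ∀ n x (f : ℕ → ℕ) → 1 ≤ x → x ≤ n → ∑ n (λ ℓ → f ℓ * 𝟙 (x ≡ᵇ ℓ)) ≡ f x
∑-select zero    _ f (s≤s _) ()
∑-select (suc n) x f 1≤x x≤1+n with x ≟ suc n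
... | yes refl = cong₂ _+_
  (∑-zero n λ {ℓ} _ ℓ≤n → trans (cong (f ℓ *_) (𝟙-≡ᵇ-≢ {x} {ℓ} λ { refl → <-irrefl refl (s≤s ℓ≤n) }))
                                (*-zeroʳ (f ℓ)))
  (trans (cong (λ b → f x * 𝟙 b) (dec-true (x ≟ x) refl)) (*-identityʳ (f x)))
... | no x≢1+n = begin
  ∑ n (λ ℓ → f ℓ * 𝟙 (x ≡ᵇ ℓ)) + f (suc n) * 𝟙 (x ≡ᵇ suc n)
    ≡⟨ cong₂ _+_ (∑-select n x f 1≤x (s≤s⁻¹ (≤∧≢⇒< x≤1+n x≢1+n)))
                 (cong (f (suc n) *_) (𝟙-≡ᵇ-≢ x≢1+n)) ⟩
  f x + f (suc n) * 0  ≡⟨ cong (f x +_) (*-zeroʳ (f (suc n))) ⟩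
  f x + 0              ≡⟨ +-identityʳ (f x) ⟩
  f x                  ∎
  where open ≡-Reasoning

sum-map-range1 : ∀ n (f : ℕ → ℕ) → sum (map f (range1 n)) ≡ ∑ n f
sum-map-range1 zero    f = refl
sum-map-range1 (suc n) f = begin
  sum (map f (range1 n ++ [ suc n ]))       ≡⟨ cong sum (map-++ f (range1 n) [ suc n ]) ⟩
  sum (map f (range1 n) ++ [ f (suc n) ])   ≡⟨ sum-++ (map f (range1 n)) [ f (suc n) ] ⟩
  sum (map f (range1 n)) + (f (suc n) + 0)
    ≡⟨ cong₂ _+_ (sum-map-range1 n f) (+-identityʳ (f (suc n))) ⟩
  ∑ n f + f (suc n)                         ∎
  where open ≡-Reasoning

sum-map-filterᵇ : ∀ (P : ℕ → Bool) (f : ℕ → ℕ) xs →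
                  sum (map f (filterᵇ P xs)) ≡ sum (map (λ k → 𝟙 (P k) * f k) xs)
sum-map-filterᵇ P f []       = refl
sum-map-filterᵇ P f (x ∷ xs) with P x
... | true  = cong₂ _+_ (sym (+-identityʳ (f x))) (sum-map-filterᵇ P f xs)
... | false = sum-map-filterᵇ P f xs

length-filterᵇ : ∀ (P : ℕ → Bool) xs → length (filterᵇ P xs) ≡ sum (map (𝟙 ∘ P) xs)
length-filterᵇ P []       = refl
length-filterᵇ P (x ∷ xs) with P x
... | true  = cong suc (length-filterᵇ P xs)
... | false = length-filterᵇ P xs

φ≡∑ : ∀ n → φ n ≡ ∑ n (λ k → 𝟙 (gcd k n ≡ᵇ 1))
φ≡∑ n = trans (length-filterᵇ _ (range1 n)) (sum-map-range1 n _)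

-- Counting by gcd

gcd-*ʳ : ∀ m n c → gcd (m * c) (n * c) ≡ gcd m n * c
gcd-*ʳ m n c = begin
  gcd (m * c) (n * c)  ≡⟨ cong₂ gcd (*-comm m c) (*-comm n c) ⟩
  gcd (c * m) (c * n)  ≡⟨ c*gcd[m,n]≡gcd[cm,cn] c m n ⟨
  c * gcd m n          ≡⟨ *-comm c (gcd m n) ⟩
  gcd m n * c          ∎
  where open ≡-Reasoning

∑-gcd≡ : ∀ n ℓ → 1 ≤ ℓ → ∑ n (λ k → 𝟙 (gcd k n ≡ᵇ ℓ)) ≡ 𝟙 ⌊ ℓ ∣? n ⌋ * φ (n div ℓ)
∑-gcd≡ n ℓ@(suc l) _ with ℓ ∣? n
... | no ℓ∤n =
  ∑-zero n λ {k} _ _ → 𝟙-≡ᵇ-≢ λ gcd≡ℓ → ℓ∤n (subst (_∣ n) gcd≡ℓ (gcd[m,n]∣n k n))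
... | yes (divides q refl) = begin
  ∑ (q * ℓ) (λ k → 𝟙 (gcd k (q * ℓ) ≡ᵇ ℓ))   ≡⟨ ∑-multiples l q _ off-multiples ⟩
  ∑ q (λ j → 𝟙 (gcd (j * ℓ) (q * ℓ) ≡ᵇ ℓ))   ≡⟨ ∑-cong q (λ {j} _ _ → cong 𝟙 (rescale j)) ⟩
  ∑ q (λ j → 𝟙 (gcd j q ≡ᵇ 1))               ≡⟨ φ≡∑ q ⟨
  φ q                                         ≡⟨ cong φ (m*n/n≡m q ℓ) ⟨
  φ (q * ℓ / ℓ)                               ≡⟨ +-identityʳ _ ⟨
  1 * φ ((q * ℓ) div ℓ)                       ∎
  where
  open ≡-Reasoning
  off-multiples : ∀ k → ¬ ℓ ∣ k → 𝟙 (gcd k (q * ℓ) ≡ᵇ ℓ) ≡ 0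
  off-multiples k ℓ∤k =
    𝟙-≡ᵇ-≢ λ gcd≡ℓ → ℓ∤k (subst (_∣ k) gcd≡ℓ (gcd[m,n]∣m k (q * ℓ)))
  rescale : ∀ j → (gcd (j * ℓ) (q * ℓ) ≡ᵇ ℓ) ≡ (gcd j q ≡ᵇ 1)
  rescale j = does-⇔ (mk⇔ to from) (_ ≟ _) (_ ≟ _)
    where
    to : gcd (j * ℓ) (q * ℓ) ≡ ℓ → gcd j q ≡ 1
    to eq = *-cancelʳ-≡ (gcd j q) 1 ℓ (trans (sym (gcd-*ʳ j q ℓ)) (trans eq (sym (*-identityˡ ℓ))))
    from : gcd j q ≡ 1 → gcd (j * ℓ) (q * ℓ) ≡ ℓ
    from eq = trans (gcd-*ʳ j q ℓ) (trans (cong (_* ℓ) eq) (*-identityˡ ℓ))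

∑-divisors-φ : ∀ n (P : ℕ → Bool) →
               ∑ n (λ ℓ → 𝟙 (⌊ ℓ ∣? n ⌋ ∧ P ℓ) * φ (n div ℓ)) ≡ ∑ n (λ k → 𝟙 (P (gcd k n)))
∑-divisors-φ zero        P = refl
∑-divisors-φ n@(suc _) P = begin
  ∑ n (λ ℓ → 𝟙 (⌊ ℓ ∣? n ⌋ ∧ P ℓ) * φ (n div ℓ))        ≡⟨ ∑-cong n (λ {ℓ} 1≤ℓ _ → fibre ℓ 1≤ℓ) ⟩
  ∑ n (λ ℓ → ∑ n (λ k → 𝟙 (P ℓ) * 𝟙 (gcd k n ≡ᵇ ℓ)))    ≡⟨ ∑-swap n n _ ⟩
  ∑ n (λ k → ∑ n (λ ℓ → 𝟙 (P ℓ) * 𝟙 (gcd k n ≡ᵇ ℓ)))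
    ≡⟨ ∑-cong n (λ {k} _ _ → ∑-select n (gcd k n) (𝟙 ∘ P) (gcd≥1 k) (gcd[m,n]≤n k n)) ⟩
  ∑ n (λ k → 𝟙 (P (gcd k n)))                              ∎
  where
  open ≡-Reasoning
  gcd≥1 : ∀ k → 1 ≤ gcd k n
  gcd≥1 k = n≢0⇒n>0 (gcd[m,n]≢0 k n (inj₂ λ ()))
  fibre : ∀ ℓ → 1 ≤ ℓ →
          𝟙 (⌊ ℓ ∣? n ⌋ ∧ P ℓ) * φ (n div ℓ) ≡ ∑ n (λ k → 𝟙 (P ℓ) * 𝟙 (gcd k n ≡ᵇ ℓ))
  fibre ℓ 1≤ℓ = begin
    𝟙 (⌊ ℓ ∣? n ⌋ ∧ P ℓ) * φ (n div ℓ)         ≡⟨ 𝟙-∧-* ⌊ ℓ ∣? n ⌋ (P ℓ) _ ⟩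
    𝟙 (P ℓ) * (𝟙 ⌊ ℓ ∣? n ⌋ * φ (n div ℓ))     ≡⟨ cong (𝟙 (P ℓ) *_) (∑-gcd≡ n ℓ 1≤ℓ) ⟨
    𝟙 (P ℓ) * ∑ n (λ k → 𝟙 (gcd k n ≡ᵇ ℓ))     ≡⟨ ∑-*ˡ n (𝟙 (P ℓ)) _ ⟩
    ∑ n (λ k → 𝟙 (P ℓ) * 𝟙 (gcd k n ≡ᵇ ℓ))     ∎

-- Multiplicative orders

pow∸1-+ : ∀ r a b .{{_ : NonZero r}} → r ^ (a + b) ∸ 1 ≡ r ^ a * (r ^ b ∸ 1) + (r ^ a ∸ 1)
pow∸1-+ r a b =
  trans (cong (_∸ 1) (^-distribˡ-+-* r a b)) (*∸1 (r ^ a) (r ^ b) {{m^n≢0 r a}} {{m^n≢0 r b}})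
  where
  *∸1 : ∀ x y .{{_ : NonZero x}} .{{_ : NonZero y}} → x * y ∸ 1 ≡ x * (y ∸ 1) + (x ∸ 1)
  *∸1 (suc x) (suc y) = identity x y
    where
    identity : ∀ x y → y + x * suc y ≡ y + x * y + x
    identity = solve-∀

module _ {n r : ℕ} .{{_ : NonZero r}} where

  ∣pow∸1-+ : ∀ a b → n ∣ r ^ a ∸ 1 → n ∣ r ^ b ∸ 1 → n ∣ r ^ (a + b) ∸ 1
  ∣pow∸1-+ a b n∣a n∣b =
    subst (n ∣_) (sym (pow∸1-+ r a b)) (∣m∣n⇒∣m+n (∣n⇒∣m*n (r ^ a) n∣b) n∣a)

  ∣pow∸1-+-cancelʳ : ∀ a b → n ∣ r ^ b ∸ 1 → n ∣ r ^ (a + b) ∸ 1 → n ∣ r ^ a ∸ 1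
  ∣pow∸1-+-cancelʳ a b n∣b n∣a+b =
    ∣m+n∣m⇒∣n (subst (n ∣_) (pow∸1-+ r a b) n∣a+b) (∣n⇒∣m*n (r ^ a) n∣b)

  ∣pow∸1-* : ∀ k a → n ∣ r ^ a ∸ 1 → n ∣ r ^ (k * a) ∸ 1
  ∣pow∸1-* zero    a n∣a = n ∣0
  ∣pow∸1-* (suc k) a n∣a = ∣pow∸1-+ a (k * a) n∣a (∣pow∸1-* k a n∣a)

record IsOrder (n r e : ℕ) : Set where
  field
    1≤e    : 1 ≤ e
    ∣pow∸1 : n ∣ r ^ e ∸ 1
    least  : ∀ {j} → 1 ≤ j → n ∣ r ^ j ∸ 1 → e ≤ j

module _ {n r e : ℕ} .{{_ : NonZero r}} (order : IsOrder n r e) where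
  open IsOrder order

  ∣pow∸1⇔order∣ : ∀ ℓ → n ∣ r ^ ℓ ∸ 1 ⇔ e ∣ ℓ
  ∣pow∸1⇔order∣ ℓ = mk⇔ to from
    where
    instance
      e≢0 : NonZero e
      e≢0 = >-nonZero 1≤e
    below-order : ∀ {t} → t < e → n ∣ r ^ t ∸ 1 → t ≡ 0
    below-order {zero}  _   _ = refl
    below-order {suc t} t<e d = contradiction (least z<s d) (<⇒≱ t<e)
    to : n ∣ r ^ ℓ ∸ 1 → e ∣ ℓ
    to n∣ℓ = m%n≡0⇒n∣m ℓ e (below-order (m%n<n ℓ e) n∣rʳᵉᵐ∸1)
      where
      n∣rʳᵉᵐ∸1 : n ∣ r ^ (ℓ % e) ∸ 1
      n∣rʳᵉᵐ∸1 = ∣pow∸1-+-cancelʳ (ℓ % e) (ℓ / e * e) (∣pow∸1-* (ℓ / e) e ∣pow∸1)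
                   (subst (λ x → n ∣ r ^ x ∸ 1) (m≡m%n+[m/n]*n ℓ e) n∣ℓ)
    from : e ∣ ℓ → n ∣ r ^ ℓ ∸ 1
    from (divides k refl) = ∣pow∸1-* k e ∣pow∸1

%≡1⇔∣∸1 : ∀ n a → 1 ≤ a → a % suc (suc n) ≡ 1 ⇔ suc (suc n) ∣ a ∸ 1
%≡1⇔∣∸1 n a@(suc a′) _ = mk⇔ to from
  where
  N = suc (suc n)
  to : a % N ≡ 1 → N ∣ a ∸ 1
  to a%N≡1 = divides (a / N) (cong (_∸ 1) (trans (m≡m%n+[m/n]*n a N) (cong (_+ a / N * N) a%N≡1)))
  from : N ∣ a ∸ 1 → a % N ≡ 1
  from (divides c a′≡cN) = trans (cong (λ x → suc x % N) a′≡cN) ([m+kn]%n≡m%n 1 c N)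

T-≡1mod⇔∣∸1 : ∀ n a → 2 ≤ n → 1 ≤ a → T (≡1mod a n) ⇔ n ∣ a ∸ 1
T-≡1mod⇔∣∸1 (suc (suc n)) a (s≤s (s≤s z≤n)) 1≤a = mk⇔
  (λ t → Equivalence.to (%≡1⇔∣∸1 n a 1≤a) (≡ᵇ⇒≡ _ 1 t))
  (λ d → ≡⇒≡ᵇ _ 1 (Equivalence.from (%≡1⇔∣∸1 n a 1≤a) d))

firstOrd-applyUpTo : ∀ m r (f : ℕ → ℕ) n i → i < n → T (≡1mod (r ^ f i) m) →
  ∃[ i₀ ] i₀ ≤ i × firstOrd m r (applyUpTo f n) ≡ f i₀ × T (≡1mod (r ^ f i₀) m)
          × (∀ {j} → j < i₀ → ¬ T (≡1mod (r ^ f j) m))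
firstOrd-applyUpTo m r f (suc n) zero _ hit with ≡1mod (r ^ f 0) m in eq
... | true  = 0 , z≤n , refl , subst T (sym eq) _ , λ ()
... | false = ⊥-elim hit
firstOrd-applyUpTo m r f (suc n) (suc i) (s≤s i<n) hit with ≡1mod (r ^ f 0) m in eq
... | true  = 0 , z≤n , refl , subst T (sym eq) _ , λ ()
... | false =
  let i₀ , i₀≤i , first≡ , hit₀ , misses = firstOrd-applyUpTo m r (f ∘ suc) n i i<n hit
  in  suc i₀ , s≤s i₀≤i , first≡ , hit₀ , λ { {zero}  _          → subst T eq
                                            ; {suc j} (s≤s j<i₀) → misses j<i₀ }

range1≡applyUpTo : ∀ n → range1 n ≡ applyUpTo suc n
range1≡applyUpTo zero    = refl
range1≡applyUpTo (suc n) = trans (cong (_++ [ suc n ]) (range1≡applyUpTo n)) (applyUpTo-∷ʳ suc n)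

module _ {n r : ℕ} .{{_ : NonZero r}} (2≤n : 2 ≤ n) where

  T-≡1mod-pow⇔ : ∀ j → T (≡1mod (r ^ j) n) ⇔ n ∣ r ^ j ∸ 1
  T-≡1mod-pow⇔ j = T-≡1mod⇔∣∸1 n (r ^ j) 2≤n (m^n>0 r j)

  ord-isOrder : ∀ {K} → 1 ≤ K → K ≤ n → n ∣ r ^ K ∸ 1 → IsOrder n r (ord n r) × ord n r ≤ K
  ord-isOrder {suc i} _ K≤n n∣K
    with i₀ , i₀≤i , first≡ , hit₀ , misses ←
         firstOrd-applyUpTo n r suc n i K≤n (Equivalence.from (T-≡1mod-pow⇔ (suc i)) n∣K)
    rewrite range1≡applyUpTo n | first≡ = order , s≤s i₀≤i
    where
    below : ∀ j → 1 ≤ j → j < suc i₀ → ¬ n ∣ r ^ j ∸ 1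
    below (suc j) _ (s≤s j<i₀) n∣j = misses j<i₀ (Equivalence.from (T-≡1mod-pow⇔ (suc j)) n∣j)
    order : IsOrder n r (suc i₀)
    order = record
      { 1≤e    = s≤s z≤n
      ; ∣pow∸1 = Equivalence.to (T-≡1mod-pow⇔ (suc i₀)) hit₀
      ; least  = λ {j} 1≤j n∣j → ≮⇒≥ λ j<1+i₀ → below j 1≤j j<1+i₀ n∣j
      }

%≡%⇒∣∸ : ∀ x y n .{{_ : NonZero n}} → x % n ≡ y % n → n ∣ x ∸ y
%≡%⇒∣∸ x y n x%n≡y%n = divides (x / n ∸ y / n) (begin
  x ∸ y                                      ≡⟨ cong₂ _∸_ (m≡m%n+[m/n]*n x n) (m≡m%n+[m/n]*n y n) ⟩
  (x % n + x / n * n) ∸ (y % n + y / n * n)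
    ≡⟨ cong (λ z → (x % n + x / n * n) ∸ (z + y / n * n)) x%n≡y%n ⟨
  (x % n + x / n * n) ∸ (x % n + y / n * n)  ≡⟨ [m+n]∸[m+o]≡n∸o (x % n) (x / n * n) (y / n * n) ⟩
  x / n * n ∸ y / n * n                      ≡⟨ *-distribʳ-∸ n (x / n) (y / n) ⟨
  (x / n ∸ y / n) * n                        ∎)
  where open ≡-Reasoning

coprime-∣pow* : ∀ {n r} a {x} → Coprime n r → n ∣ r ^ a * x → n ∣ x
coprime-∣pow* {n}     zero    {x} n⊥r n∣x     = subst (n ∣_) (+-identityʳ x) n∣x
coprime-∣pow* {n} {r} (suc a) {x} n⊥r n∣rʳx =
  coprime-∣pow* a n⊥r (coprime-divisor n⊥r (subst (n ∣_) (*-assoc r (r ^ a) x) n∣rʳx))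

-- pigeonhole on the residues of r⁰, …, rⁿ modulo n
pow∸1-exists : ∀ n r .{{_ : NonZero n}} → Coprime n r → ∃[ K ] 1 ≤ K × K ≤ n × n ∣ r ^ K ∸ 1
pow∸1-exists n r n⊥r =
  let i , j , i<j , residues≡ = Fin.pigeonhole (n<1+n n) residue
  in  toℕ j ∸ toℕ i , m<n⇒0<n∸m i<j , ≤-trans (m∸n≤m (toℕ j) (toℕ i)) (s≤s⁻¹ (Fin.toℕ<n j))
    , collision (toℕ i) (toℕ j) i<j (toℕ-residue≡ i j residues≡)
  where
  residue : Fin (suc n) → Fin n
  residue i = fromℕ< (m%n<n (r ^ toℕ i) n)
  toℕ-residue≡ : ∀ i j → residue i ≡ residue j → r ^ toℕ i % n ≡ r ^ toℕ j % n
  toℕ-residue≡ i j eq = trans (sym (Fin.toℕ-fromℕ< (m%n<n (r ^ toℕ i) n)))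
                         (trans (cong toℕ eq) (Fin.toℕ-fromℕ< (m%n<n (r ^ toℕ j) n)))
  collision : ∀ a b → a < b → r ^ a % n ≡ r ^ b % n → n ∣ r ^ (b ∸ a) ∸ 1
  collision a b a<b residues≡ =
    coprime-∣pow* a n⊥r (subst (n ∣_) difference (%≡%⇒∣∸ (r ^ b) (r ^ a) n (sym residues≡)))
    where
    open ≡-Reasoning
    difference : r ^ b ∸ r ^ a ≡ r ^ a * (r ^ (b ∸ a) ∸ 1)
    difference = begin
      r ^ b ∸ r ^ a                    ≡⟨ cong (λ c → r ^ c ∸ r ^ a) (m+[n∸m]≡n (<⇒≤ a<b)) ⟨
      r ^ (a + (b ∸ a)) ∸ r ^ a
        ≡⟨ cong₂ _∸_ (^-distribˡ-+-* r a (b ∸ a)) (sym (*-identityʳ (r ^ a))) ⟩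
      r ^ a * r ^ (b ∸ a) ∸ r ^ a * 1  ≡⟨ *-distribˡ-∸ (r ^ a) (r ^ (b ∸ a)) 1 ⟨
      r ^ a * (r ^ (b ∸ a) ∸ 1)        ∎

-- Coprimality

prime∤⇒coprime : ∀ {p x} → Prime p → ¬ p ∣ x → Coprime x p
prime∤⇒coprime p-prime p∤x (d∣x , d∣p) with prime⇒irreducible p-prime d∣p
... | inj₁ d≡1 = d≡1
... | inj₂ refl = contradiction d∣x p∤x

coprime-*ʳ : ∀ {x a b} → Coprime x a → Coprime x b → Coprime x (a * b)
coprime-*ʳ x⊥a x⊥b (d∣x , d∣ab) =
  x⊥b (d∣x , coprime-divisor (λ (e∣d , e∣a) → x⊥a (∣-trans e∣d d∣x , e∣a)) d∣ab)

coprime-∣⇒*∣ : ∀ {a b x} → Coprime b a → a ∣ x → b ∣ x → a * b ∣ x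
coprime-∣⇒*∣ {a} {b} b⊥a (divides c refl) b∣ca =
  subst (_∣ c * a) (*-comm b a) (*-monoˡ-∣ a (coprime-divisor b⊥a (subst (b ∣_) (*-comm c a) b∣ca)))

gcd[x,pq]≡1⇔ : ∀ {p q x} → Prime p → Prime q → gcd x (p * q) ≡ 1 ⇔ (¬ p ∣ x × ¬ q ∣ x)
gcd[x,pq]≡1⇔ {p} {q} {x} p-prime q-prime = mk⇔
  (λ gcd≡1 → let x⊥pq = gcd≡1⇒coprime gcd≡1 in
     (λ p∣x → nonTrivial⇒≢1 {{prime⇒nonTrivial p-prime}} (x⊥pq (p∣x , m∣m*n q)))
   , (λ q∣x → nonTrivial⇒≢1 {{prime⇒nonTrivial q-prime}} (x⊥pq (q∣x , n∣m*n p))))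
  (λ (p∤x , q∤x) →
     coprime⇒gcd≡1 (coprime-*ʳ (prime∤⇒coprime p-prime p∤x) (prime∤⇒coprime q-prime q∤x)))

-- The sum 𝒮(1, r, t)

ord[1,r]≡1 : ∀ r → ord 1 r ≡ 1
ord[1,r]≡1 r = cong (λ b → if b ≡ᵇ 0 then 1 else 0) (n%1≡0 (r ^ 1))

κ[1,r,t]≡1 : ∀ r t → κ 1 r t ≡ 1
κ[1,r,t]≡1 r t = begin
  (1 * ord 1 r) div gcd 1 (t * S (ord 1 r) r)
    ≡⟨ cong (λ o → (1 * o) div gcd 1 (t * S o r)) (ord[1,r]≡1 r) ⟩
  1 div gcd 1 (t * S 1 r)                      ≡⟨ cong (1 div_) (gcd-zeroˡ (t * S 1 r)) ⟩
  1                                            ∎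
  where open ≡-Reasoning

𝒮[p,1,r,t]≡ : ∀ p r t → let o = ord (3 * p) r in
  𝒮 p 1 r t ≡ ∑ o (λ ℓ → 𝟙 (⌊ ℓ ∣? o ⌋ ∧ (gcd (r ^ ℓ ∸ 1) (3 * p) ≡ᵇ 1)) * φ (o div ℓ))
𝒮[p,1,r,t]≡ p r t = begin
  𝒮 p 1 r t                                  ≡⟨ cong (λ k → 𝒮-with k (gcd k o)) (κ[1,r,t]≡1 r t) ⟩
  𝒮-with 1 (gcd 1 o)                         ≡⟨ cong (𝒮-with 1) (gcd-zeroˡ o) ⟩
  𝒮-with 1 1
    ≡⟨ cong (λ N → sum (map term (filterᵇ (λ ℓ → ⌊ ℓ ∣? N ⌋ ∧ unit (ℓ * 1)) (range1 N)))) (n/1≡n o) ⟩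
  sum (map term (filterᵇ P (range1 o)))      ≡⟨ sum-map-filterᵇ P term (range1 o) ⟩
  sum (map (λ ℓ → 𝟙 (P ℓ) * term ℓ) (range1 o))  ≡⟨ sum-map-range1 o _ ⟩
  ∑ o (λ ℓ → 𝟙 (P ℓ) * term ℓ)
    ≡⟨ ∑-cong o (λ {ℓ} _ _ → cong₂ (λ a b → 𝟙 (⌊ ℓ ∣? o ⌋ ∧ unit a) * b) (*-identityʳ ℓ)
                                    (trans (*-identityˡ _) (cong (λ a → φ (o div a)) (*-identityʳ ℓ)))) ⟩
  ∑ o (λ ℓ → 𝟙 (⌊ ℓ ∣? o ⌋ ∧ unit ℓ) * φ (o div ℓ))  ∎
  where
  open ≡-Reasoning
  o = ord (3 * p) r
  unit : ℕ → Bool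
  unit x = gcd (r ^ x ∸ 1) (3 * p) ≡ᵇ 1
  𝒮-with : ℕ → ℕ → ℕ
  𝒮-with k g = sum (map (λ ℓ → 1 * φ (o div (ℓ * g)))
                        (filterᵇ (λ ℓ → ⌊ ℓ ∣? (o div g) ⌋ ∧ unit (ℓ * k)) (range1 (o div g))))
  P : ℕ → Bool
  P ℓ = ⌊ ℓ ∣? o ⌋ ∧ unit (ℓ * 1)
  term : ℕ → ℕ
  term ℓ = 1 * φ (o div (ℓ * 1))

𝒮[p,1,r,t]≡0 : ∀ p r t → r % 3 ≡ 1 → 𝒮 p 1 r t ≡ 0
𝒮[p,1,r,t]≡0 p zero      t ()
𝒮[p,1,r,t]≡0 p r@(suc _) t r%3≡1 = begin
  𝒮 p 1 r t                                                                  ≡⟨ 𝒮[p,1,r,t]≡ p r t ⟩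
  ∑ o (λ ℓ → 𝟙 (⌊ ℓ ∣? o ⌋ ∧ (gcd (r ^ ℓ ∸ 1) (3 * p) ≡ᵇ 1)) * φ (o div ℓ))
    ≡⟨ ∑-zero o (λ {ℓ} _ _ → cong (λ b → 𝟙 b * φ (o div ℓ))
                                   (trans (cong (⌊ ℓ ∣? o ⌋ ∧_) (non-unit ℓ)) (∧-zeroʳ _))) ⟩
  0                                                                          ∎
  where
  open ≡-Reasoning
  o = ord (3 * p) r
  3∣r∸1 : 3 ∣ r ^ 1 ∸ 1
  3∣r∸1 = Equivalence.to (%≡1⇔∣∸1 1 (r ^ 1) (m^n>0 r 1)) (trans (cong (_% 3) (*-identityʳ r)) r%3≡1)
  3∣rˡ∸1 : ∀ ℓ → 3 ∣ r ^ ℓ ∸ 1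
  3∣rˡ∸1 ℓ = subst (λ x → 3 ∣ r ^ x ∸ 1) (*-identityʳ ℓ) (∣pow∸1-* ℓ 1 3∣r∸1)
  non-unit : ∀ ℓ → (gcd (r ^ ℓ ∸ 1) (3 * p) ≡ᵇ 1) ≡ false
  non-unit ℓ = dec-false (_ ≟ 1) λ gcd≡1 →
    case ∣1⇒≡1 (subst (3 ∣_) gcd≡1 (gcd-greatest (3∣rˡ∸1 ℓ) (m∣m*n p))) of λ ()

odd : ℕ → Bool
odd k = not (does (2 ∣? k))

oddNonMultiple : ℕ → ℕ → Bool
oddNonMultiple m k = odd k ∧ not (does (m ∣? k))

𝟙-∧-split : ∀ a b → 𝟙 (a ∧ not b) + 𝟙 (a ∧ b) ≡ 𝟙 a
𝟙-∧-split false b     = refl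
𝟙-∧-split true  false = refl
𝟙-∧-split true  true  = refl

∑-odd : ∀ j → ∑ (2 * j) (𝟙 ∘ odd) ≡ j
∑-odd zero    = refl
∑-odd (suc j) = begin
  ∑ (2 * suc j) (𝟙 ∘ odd)                           ≡⟨ cong (λ n → ∑ n (𝟙 ∘ odd)) (*-suc 2 j) ⟩
  ∑ (2 * j) (𝟙 ∘ odd) + 𝟙 (odd (1 + 2 * j)) + 𝟙 (odd (2 + 2 * j))
    ≡⟨ cong₂ _+_ (cong₂ _+_ (∑-odd j) (cong (𝟙 ∘ not) (dec-false (2 ∣? 1 + 2 * j) 2∤1+2j)))
                 (cong (𝟙 ∘ not) (dec-true (2 ∣? 2 + 2 * j) (∣m∣n⇒∣m+n ∣-refl (m∣m*n j)))) ⟩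
  j + 1 + 0                                         ≡⟨ trans (+-identityʳ (j + 1)) (+-comm j 1) ⟩
  suc j                                             ∎
  where
  open ≡-Reasoning
  2∤1+2j : ¬ 2 ∣ 1 + 2 * j
  2∤1+2j 2∣1+2j = >⇒∤ (s≤s (s≤s z≤n)) (∣m+n∣m⇒∣n (subst (2 ∣_) (+-comm 1 (2 * j)) 2∣1+2j) (m∣m*n j))

∑-oddNonMultiple-odd : ∀ m → ¬ 2 ∣ m → ∑ (2 * m) (𝟙 ∘ oddNonMultiple m) ≡ m ∸ 1
∑-oddNonMultiple-odd zero       2∤m = contradiction (2 ∣0) 2∤m
∑-oddNonMultiple-odd m@(suc m′) 2∤m =
  trans (sym (m+n∸n≡m (∑ (2 * m) (𝟙 ∘ oddNonMultiple m)) 1)) (cong (_∸ 1) nonMultiples+1≡m)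
  where
  open ≡-Reasoning
  oddMultiple : ℕ → Bool
  oddMultiple k = odd k ∧ does (m ∣? k)
  oddMultiples≡1 : ∑ (2 * m) (𝟙 ∘ oddMultiple) ≡ 1
  oddMultiples≡1 = begin
    ∑ (2 * m) (𝟙 ∘ oddMultiple)                        ≡⟨ ∑-multiples m′ 2 (𝟙 ∘ oddMultiple) vanishes ⟩
    𝟙 (oddMultiple (1 * m)) + 𝟙 (oddMultiple (2 * m))
      ≡⟨ cong₂ _+_ (cong₂ (λ a b → 𝟙 (not a ∧ b))
                          (dec-false (2 ∣? 1 * m) (2∤m ∘ subst (2 ∣_) (*-identityˡ m)))
                          (dec-true (m ∣? 1 * m) (n∣m*n 1)))
                   (cong (λ a → 𝟙 (not a ∧ does (m ∣? 2 * m))) (dec-true (2 ∣? 2 * m) (m∣m*n m))) ⟩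
    1                                                  ∎
    where
    vanishes : ∀ k → ¬ m ∣ k → 𝟙 (oddMultiple k) ≡ 0
    vanishes k m∤k = cong 𝟙 (trans (cong (odd k ∧_) (dec-false (m ∣? k) m∤k)) (∧-zeroʳ _))
  nonMultiples+1≡m : ∑ (2 * m) (𝟙 ∘ oddNonMultiple m) + 1 ≡ m
  nonMultiples+1≡m = begin
    ∑ (2 * m) (𝟙 ∘ oddNonMultiple m) + 1
      ≡⟨ cong (∑ (2 * m) (𝟙 ∘ oddNonMultiple m) +_) oddMultiples≡1 ⟨
    ∑ (2 * m) (𝟙 ∘ oddNonMultiple m) + ∑ (2 * m) (𝟙 ∘ oddMultiple)  ≡⟨ ∑-+ (2 * m) _ _ ⟨
    ∑ (2 * m) (λ k → 𝟙 (oddNonMultiple m k) + 𝟙 (oddMultiple k))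
      ≡⟨ ∑-cong (2 * m) (λ {k} _ _ → 𝟙-∧-split (odd k) (does (m ∣? k))) ⟩
    ∑ (2 * m) (𝟙 ∘ odd)                                             ≡⟨ ∑-odd m ⟩
    m                                                               ∎

∑-oddNonMultiple-even : ∀ m → 2 ∣ m → ∑ m (𝟙 ∘ oddNonMultiple m) ≡ m / 2
∑-oddNonMultiple-even m 2∣m = begin
  ∑ m (𝟙 ∘ oddNonMultiple m)     ≡⟨ ∑-cong m (λ {k} _ _ → cong 𝟙 (oddNonMultiple≡odd k)) ⟩
  ∑ m (𝟙 ∘ odd)                  ≡⟨ cong (λ n → ∑ n (𝟙 ∘ odd)) (m*[n/m]≡n 2∣m) ⟨
  ∑ (2 * (m / 2)) (𝟙 ∘ odd)      ≡⟨ ∑-odd (m / 2) ⟩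
  m / 2                          ∎
  where
  open ≡-Reasoning
  oddNonMultiple≡odd : ∀ k → oddNonMultiple m k ≡ odd k
  oddNonMultiple≡odd k =
    does-⇔ (mk⇔ proj₁ λ 2∤k → 2∤k , 2∤k ∘ ∣-trans 2∣m) (¬? (2 ∣? k) ×-dec ¬? (m ∣? k)) (¬? (2 ∣? k))

module _ {p r : ℕ} (p-prime : Prime p) (3<p : 3 < p) .{{_ : NonZero r}} (r⊥3p : gcd r (3 * p) ≡ 1)
         (r%3≡2 : r % 3 ≡ 2) where

  private
    open Equivalence using (to; from)

    instance
      p≢0 : NonZero p
      p≢0 = prime⇒nonZero p-prime

    m = ord p r
    o = ord (3 * p) r

    2≤p : 2 ≤ p
    2≤p = ≤-trans (s≤s (s≤s z≤n)) (<⇒≤ 3<p)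

    p⊥r : Coprime p r
    p⊥r (d∣p , d∣r) = gcd≡1⇒coprime r⊥3p (d∣r , ∣n⇒∣m*n 3 d∣p)

    order-p×m≤p : IsOrder p r m × m ≤ p
    order-p×m≤p =
      let K , 1≤K , K≤p , p∣rᴷ∸1 = pow∸1-exists p r p⊥r
          order , m≤K = ord-isOrder 2≤p 1≤K K≤p p∣rᴷ∸1
      in  order , ≤-trans m≤K K≤p

    order-p : IsOrder p r m
    order-p = proj₁ order-p×m≤p

    r¹%3≡2 : r ^ 1 % 3 ≡ 2
    r¹%3≡2 = trans (cong (_% 3) (*-identityʳ r)) r%3≡2

    r¹%3≡1⇔ : r ^ 1 % 3 ≡ 1 ⇔ 3 ∣ r ^ 1 ∸ 1
    r¹%3≡1⇔ = %≡1⇔∣∸1 1 (r ^ 1) (m^n>0 r 1)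

    order-3 : IsOrder 3 r 2
    order-3 = record
      { 1≤e    = s≤s z≤n
      ; ∣pow∸1 = to (%≡1⇔∣∸1 1 (r ^ 2) (m^n>0 r 2))
                    (trans (%-distribˡ-* r (r ^ 1) 3) (cong₂ (λ a b → a * b % 3) r%3≡2 r¹%3≡2))
      ; least  = λ { {1}           _ 3∣r¹∸1 → case trans (sym r¹%3≡2) (from r¹%3≡1⇔ 3∣r¹∸1) of λ ()
                   ; {suc (suc _)} _ _      → s≤s (s≤s z≤n) }
      }

    3∣⇔2∣ : ∀ ℓ → 3 ∣ r ^ ℓ ∸ 1 ⇔ 2 ∣ ℓ
    3∣⇔2∣ = ∣pow∸1⇔order∣ order-3

    p∣⇔m∣ : ∀ ℓ → p ∣ r ^ ℓ ∸ 1 ⇔ m ∣ ℓ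
    p∣⇔m∣ = ∣pow∸1⇔order∣ order-p

    3p∣⇔2∣×m∣ : ∀ ℓ → 3 * p ∣ r ^ ℓ ∸ 1 ⇔ (2 ∣ ℓ × m ∣ ℓ)
    3p∣⇔2∣×m∣ ℓ = mk⇔
      (λ 3p∣ → to (3∣⇔2∣ ℓ) (∣-trans (m∣m*n p) 3p∣) , to (p∣⇔m∣ ℓ) (∣-trans (n∣m*n 3) 3p∣))
      (λ (2∣ℓ , m∣ℓ) → coprime-∣⇒*∣ (prime⇒coprime p-prime 3<p) (from (3∣⇔2∣ ℓ) 2∣ℓ) (from (p∣⇔m∣ ℓ) m∣ℓ))

    gcd≡1⇔odd×m∤ : ∀ ℓ → gcd (r ^ ℓ ∸ 1) (3 * p) ≡ 1 ⇔ (¬ 2 ∣ ℓ × ¬ m ∣ ℓ)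
    gcd≡1⇔odd×m∤ ℓ = mk⇔
      (λ gcd≡1 → let 3∤ , p∤ = to (gcd[x,pq]≡1⇔ 3-prime p-prime) gcd≡1
                 in  3∤ ∘ from (3∣⇔2∣ ℓ) , p∤ ∘ from (p∣⇔m∣ ℓ))
      (λ (2∤ℓ , m∤ℓ) → from (gcd[x,pq]≡1⇔ 3-prime p-prime) (2∤ℓ ∘ to (3∣⇔2∣ ℓ) , m∤ℓ ∘ to (p∣⇔m∣ ℓ)))
      where
      3-prime : Prime 3
      3-prime = from-yes (prime? 3)

    1≤2m : 1 ≤ 2 * m
    1≤2m = ≤-trans (IsOrder.1≤e order-p) (m≤n*m m 2)

    3p∣r²ᵐ∸1 : 3 * p ∣ r ^ (2 * m) ∸ 1
    3p∣r²ᵐ∸1 = from (3p∣⇔2∣×m∣ (2 * m)) (m∣m*n m , n∣m*n 2)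

    order-3p : IsOrder (3 * p) r o
    order-3p =
      proj₁ (ord-isOrder (≤-trans 2≤p (m≤n*m p 3)) 1≤2m (*-mono-≤ (n≤1+n 2) (proj₂ order-p×m≤p)) 3p∣r²ᵐ∸1)

    2∣o×m∣o : 2 ∣ o × m ∣ o
    2∣o×m∣o = to (3p∣⇔2∣×m∣ o) (IsOrder.∣pow∸1 order-3p)

    ∣o⇒∣gcd⇔∣ : ∀ {d} k → d ∣ o → d ∣ gcd k o ⇔ d ∣ k
    ∣o⇒∣gcd⇔∣ k d∣o = mk⇔ (λ d∣gcd → ∣-trans d∣gcd (gcd[m,n]∣m k o)) (λ d∣k → gcd-greatest d∣k d∣o)

    oddNonMultiple-gcd : ∀ k → oddNonMultiple m (gcd k o) ≡ oddNonMultiple m k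
    oddNonMultiple-gcd k = does-⇔
      (mk⇔ (λ (2∤ , m∤) → 2∤ ∘ from (2∣gcd⇔2∣) , m∤ ∘ from (m∣gcd⇔m∣))
           (λ (2∤ , m∤) → 2∤ ∘ to (2∣gcd⇔2∣) , m∤ ∘ to (m∣gcd⇔m∣)))
      (¬? (2 ∣? gcd k o) ×-dec ¬? (m ∣? gcd k o)) (¬? (2 ∣? k) ×-dec ¬? (m ∣? k))
      where
      2∣gcd⇔2∣ = ∣o⇒∣gcd⇔∣ k (proj₁ 2∣o×m∣o)
      m∣gcd⇔m∣ = ∣o⇒∣gcd⇔∣ k (proj₂ 2∣o×m∣o)

    𝒮≡∑oddNonMultiple : ∀ t → 𝒮 p 1 r t ≡ ∑ o (𝟙 ∘ oddNonMultiple m)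
    𝒮≡∑oddNonMultiple t = begin
      𝒮 p 1 r t                                                       ≡⟨ 𝒮[p,1,r,t]≡ p r t ⟩
      ∑ o (λ ℓ → 𝟙 (⌊ ℓ ∣? o ⌋ ∧ (gcd (r ^ ℓ ∸ 1) (3 * p) ≡ᵇ 1)) * φ (o div ℓ))
        ≡⟨ ∑-cong o (λ {ℓ} _ _ → cong (λ b → 𝟙 (⌊ ℓ ∣? o ⌋ ∧ b) * φ (o div ℓ)) (unit≡oddNonMultiple ℓ)) ⟩
      ∑ o (λ ℓ → 𝟙 (⌊ ℓ ∣? o ⌋ ∧ oddNonMultiple m ℓ) * φ (o div ℓ))  ≡⟨ ∑-divisors-φ o (oddNonMultiple m) ⟩
      ∑ o (λ k → 𝟙 (oddNonMultiple m (gcd k o)))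
        ≡⟨ ∑-cong o (λ {k} _ _ → cong 𝟙 (oddNonMultiple-gcd k)) ⟩
      ∑ o (𝟙 ∘ oddNonMultiple m)                                       ∎
      where
      open ≡-Reasoning
      unit≡oddNonMultiple : ∀ ℓ → (gcd (r ^ ℓ ∸ 1) (3 * p) ≡ᵇ 1) ≡ oddNonMultiple m ℓ
      unit≡oddNonMultiple ℓ = does-⇔ (gcd≡1⇔odd×m∤ ℓ) (_ ≟ 1) (¬? (2 ∣? ℓ) ×-dec ¬? (m ∣? ℓ))

    o≡2m : ¬ 2 ∣ m → o ≡ 2 * m
    o≡2m 2∤m = ≤-antisym (IsOrder.least order-3p 1≤2m 3p∣r²ᵐ∸1)
                         (∣⇒≤ {{>-nonZero (IsOrder.1≤e order-3p)}} 2m∣o)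
      where
      2m∣o : 2 * m ∣ o
      2m∣o = coprime-∣⇒*∣ (prime∤⇒coprime prime[2] 2∤m) (proj₁ 2∣o×m∣o) (proj₂ 2∣o×m∣o)

    o≡m : 2 ∣ m → o ≡ m
    o≡m 2∣m = ≤-antisym (IsOrder.least order-3p (IsOrder.1≤e order-p) 3p∣rᵐ∸1)
                        (∣⇒≤ {{>-nonZero (IsOrder.1≤e order-3p)}} (proj₂ 2∣o×m∣o))
      where
      3p∣rᵐ∸1 : 3 * p ∣ r ^ m ∸ 1
      3p∣rᵐ∸1 = from (3p∣⇔2∣×m∣ m) (2∣m , ∣-refl)

  𝒮[p,1,r,t]≡ord∸1 : ∀ t → ord p r % 2 ≡ 1 → 𝒮 p 1 r t ≡ ord p r ∸ 1
  𝒮[p,1,r,t]≡ord∸1 t m%2≡1 = begin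
    𝒮 p 1 r t                         ≡⟨ 𝒮≡∑oddNonMultiple t ⟩
    ∑ o (𝟙 ∘ oddNonMultiple m)        ≡⟨ cong (λ n → ∑ n (𝟙 ∘ oddNonMultiple m)) (o≡2m 2∤m) ⟩
    ∑ (2 * m) (𝟙 ∘ oddNonMultiple m)  ≡⟨ ∑-oddNonMultiple-odd m 2∤m ⟩
    m ∸ 1                             ∎
    where
    open ≡-Reasoning
    2∤m : ¬ 2 ∣ m
    2∤m 2∣m = case trans (sym (n∣m⇒m%n≡0 m 2 2∣m)) m%2≡1 of λ ()

  𝒮[p,1,r,t]≡ord/2 : ∀ t → ord p r % 2 ≡ 0 → 𝒮 p 1 r t ≡ ord p r / 2
  𝒮[p,1,r,t]≡ord/2 t m%2≡0 = begin
    𝒮 p 1 r t                   ≡⟨ 𝒮≡∑oddNonMultiple t ⟩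
    ∑ o (𝟙 ∘ oddNonMultiple m)  ≡⟨ cong (λ n → ∑ n (𝟙 ∘ oddNonMultiple m)) (o≡m 2∣m) ⟩
    ∑ m (𝟙 ∘ oddNonMultiple m)  ≡⟨ ∑-oddNonMultiple-even m 2∣m ⟩
    m / 2                       ∎
    where
    open ≡-Reasoning
    2∣m : 2 ∣ m
    2∣m = m%n≡0⇒n∣m m 2 m%2≡0

lemma5p8 : (p t r : ℕ) → Prime p → 3 < p
    → (t ≡ 1 ⊎ t ≡ 3 ⊎ t ≡ p ⊎ t ≡ 3 * p)
    → 1 ≤ r → r ≤ 3 * p ∸ 1 → gcd r (3 * p) ≡ 1
    → (r % 3 ≡ 1 → 𝒮 p 1 r t ≡ 0)
      × (r % 3 ≡ 2 → ord p r % 2 ≡ 1 → 𝒮 p 1 r t ≡ ord p r ∸ 1)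
      × (r % 3 ≡ 2 → ord p r % 2 ≡ 0 → 𝒮 p 1 r t ≡ ord p r / 2)
-- κ(1, r, t) = 1 for every t.
lemma5p8 p t r p-prime 3<p _ 1≤r _ r⊥3p =
    𝒮[p,1,r,t]≡0 p r t
  , (λ r%3≡2 → 𝒮[p,1,r,t]≡ord∸1 p-prime 3<p r⊥3p r%3≡2 t)
  , (λ r%3≡2 → 𝒮[p,1,r,t]≡ord/2 p-prime 3<p r⊥3p r%3≡2 t)
  where
  instance
    r≢0 : NonZero r
    r≢0 = >-nonZero 1≤r
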